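{- Let $\prec$ be a transitive and irreflexive relation on a set $A$ of labels, let $\alpha, \beta \in A$ and let $\sigma'$ be a finite list over $A$ such that $|\sigma'| -_s \mathrm{ds}(\{\beta\}) \preccurlyeq_{\mathrm{mul}} \{\#\alpha\#\}$. Then there exist lists $\sigma_1, \sigma_2, \sigma_3$ with $\sigma' = \sigma_1\sigma_2\sigma_3$, all elements of $\sigma_1$ in $\mathrm{ds}(\{\beta\})$, $\sigma_2$ of length at most $1$ with all elements equal to $\alpha$, and all elements of $\sigma_3$ in $\mathrm{ds}(\{\alpha,\beta\})$.
   Context: For $S \subseteq A$, $\mathrm{ds}(S) = \{b \mid \exists a \in S.\ b \prec a\}$. For a finite multiset $M$ and a set $S$, $M -_s S$ removes all occurrences of elements of $S$ from $M$. The lexicographic maximum measure on lists is defined by $|[\,]| = \{\#\}$ and $|\alpha\sigma| = \{\#\alpha\#\} + (|\sigma| -_s \mathrm{ds}(\{\alpha\}))$; juxtaposition denotes list concatenation. For finite multisets, $M \preccurlyeq_{\mathrm{mul}} N$ holds iff there are multisets $I, J, K$ with $M = I + K$, $N = I + J$ and every element of $K$ lies in $\mathrm{ds}(\text{set of elements of } J)$. -}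

module Defs where

open import Level using (Level; _⊔_)
open import Data.List using (List; []; _∷_; _++_; [_])
open import Data.List.Relation.Unary.All using (All)
open import Data.List.Relation.Unary.Any using (Any)
open import Data.List.Relation.Binary.Permutation.Propositional using (_↭_)
open import Data.Product using (Σ; ∃; _×_; ∃-syntax)
open import Relation.Binary.Core using (Rel)
open import Relation.Nullary using (¬_)
open import Relation.Binary.PropositionalEquality using (_≡_)

module _ {a ℓ : Level} {A : Set a} (_≺_ : Rel A ℓ) where

  -- Sets of labels are represented as predicates on A.
  -- ds(S) = { b | ∃ a ∈ S. b ≺ a }
  ds : (A → Set a) → A → Set (a ⊔ ℓ)
  ds S b = ∃[ x ] (S x × (b ≺ x))

-- Finite multisets are represented by lists, considered up to
-- permutation (_↭_).  M -ₛ S (remove all occurrences of elements of S)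
-- is given as a relation:  Remove S M M'  means  M' = M -ₛ S.
data Remove {a p : Level} {A : Set a} (S : A → Set p) : List A → List A → Set (a ⊔ p) where
  []   : Remove S [] []
  drop : ∀ {x xs ys} → S x → Remove S xs ys → Remove S (x ∷ xs) ys
  keep : ∀ {x xs ys} → ¬ S x → Remove S xs ys → Remove S (x ∷ xs) (x ∷ ys)

module _ {a ℓ : Level} {A : Set a} (_≺_ : Rel A ℓ) where

  -- Measure σ M  means  |σ| = M  (as multisets, represented by the list M):
  --   |[]| = {##},   |α σ| = {#α#} + (|σ| -ₛ ds({α})).
  data Measure : List A → List A → Set (a ⊔ ℓ) where
    []  : Measure [] []
    _∷_ : ∀ {σ M M'} (α : A) → Measure σ M → Remove (ds _≺_ (λ x → x ≡ α)) M M'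
        → Measure (α ∷ σ) (α ∷ M')

  _≼mul_ : List A → List A → Set (a ⊔ ℓ)
  M ≼mul N = ∃[ I ] ∃[ J ] ∃[ K ]
    ((M ↭ (I ++ K)) × (N ↭ (I ++ J)) × All (λ k → Any (λ j → k ≺ j) J) K)

-- The multiset |σ'| -ₛ ds(β) is ≼mul {#α#} only if it is {#α#} or all its
-- elements lie below α.  So σ' splits after its longest prefix inside ds(β):
-- the next label γ survives the removal of ds(β), hence is α or lies below α.
-- Each later label is removed by ds(γ), removed by ds(β), or survives; as ds
-- of a set is downward closed under a transitive order, in all three cases it
-- lies in ds({α, β}).
module Submission where

open import Defs
open import Level using (Level; _⊔_)
open import Function using (flip)
open import Data.Nat using (_≤_; z≤n; s≤s)
open import Data.List using (List; []; _∷_; _++_; [_]; length)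
open import Data.List.Relation.Unary.All as All using (All; []; _∷_)
open import Data.List.Relation.Unary.Any using (Any)
open import Data.List.Relation.Unary.Any.Properties using (singleton⁻)
open import Data.List.Relation.Binary.Permutation.Propositional using (_↭_; ↭-sym)
open import Data.List.Relation.Binary.Permutation.Propositional.Properties
  using (↭-singleton-inv; All-resp-↭)
open import Data.Product using (_×_; ∃-syntax; _,_)
open import Data.Sum using (_⊎_; inj₁; inj₂)
open import Relation.Unary using (Pred; _⊆_)
open import Relation.Binary.Core using (Rel)
open import Relation.Binary.Definitions using (Transitive; Irreflexive; _Respects_)
open import Relation.Binary.PropositionalEquality using (_≡_; refl)

private variable
  a p q : Level
  A : Set a
  L M N : List A

Remove-⊆-trans : {S : Pred A p} {T : Pred A q}
               → S ⊆ T → Remove S L M → Remove T M N → Remove T L N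
Remove-⊆-trans S⊆T []           r₂            = r₂
Remove-⊆-trans S⊆T (drop s r₁)  r₂            = drop (S⊆T s) (Remove-⊆-trans S⊆T r₁ r₂)
Remove-⊆-trans S⊆T (keep _ r₁)  (drop t r₂)   = drop t (Remove-⊆-trans S⊆T r₁ r₂)
Remove-⊆-trans S⊆T (keep _ r₁)  (keep ¬t r₂)  = keep ¬t (Remove-⊆-trans S⊆T r₁ r₂)

All-Remove⁻ : {S : Pred A p} {P : Pred A q}
            → S ⊆ P → Remove S M N → All P N → All P M
All-Remove⁻ S⊆P []          []         = []
All-Remove⁻ S⊆P (drop s r)  ps         = S⊆P s ∷ All-Remove⁻ S⊆P r ps
All-Remove⁻ S⊆P (keep _ r)  (p ∷ ps)   = p ∷ All-Remove⁻ S⊆P r ps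

module _ {a ℓ : Level} {A : Set a} {_≺_ : Rel A ℓ} where

  ds-mono : {S T : Pred A a} → S ⊆ T → ds _≺_ S ⊆ ds _≺_ T
  ds-mono S⊆T (x , s , y≺x) = x , S⊆T s , y≺x

  ≼mul-[_]⁻ : ∀ α → _≼mul_ _≺_ N [ α ] → All (_≺ α) N ⊎ N ≡ [ α ]
  ≼mul-[ α ]⁻ (I , J , K , N↭I++K , [α]↭I++J , K≺J) =
    cases I J (↭-singleton-inv (↭-sym [α]↭I++J)) N↭I++K K≺J
    where
    cases : ∀ I J {K} → I ++ J ≡ [ α ] → N ↭ I ++ K
          → All (λ k → Any (k ≺_) J) K → All (_≺ α) N ⊎ N ≡ [ α ]
    cases []       _  refl N↭K   K≺α = inj₁ (All-resp-↭ (↭-sym N↭K) (All.map singleton⁻ K≺α))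
    cases (_ ∷ []) [] refl N↭[α] []  = inj₂ (↭-singleton-inv N↭[α])

  module _ (≺-trans : Transitive _≺_) where

    ds-downward-closed : {S : Pred A a} → ds _≺_ S Respects flip _≺_
    ds-downward-closed y≺x (z , s , x≺z) = z , s , ≺-trans y≺x x≺z

    ds-[_]⊆ : ∀ {P : Pred A (a ⊔ ℓ)} γ → P Respects flip _≺_ → P γ
            → ds _≺_ (_≡ γ) ⊆ P
    ds-[ γ ]⊆ P-closed Pγ (_ , refl , y≺γ) = P-closed y≺γ Pγ

    All-Measure⁻ : ∀ {P : Pred A (a ⊔ ℓ)} {σ} → P Respects flip _≺_
                 → Measure _≺_ σ M → All P M → All P σ
    All-Measure⁻ P-closed []            []         = []
    All-Measure⁻ P-closed ((γ ∷ m) r)  (Pγ ∷ ps)  =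
      Pγ ∷ All-Measure⁻ P-closed m (All-Remove⁻ (ds-[ γ ]⊆ P-closed Pγ) r ps)

    module _ (α β : A) where

      ds[β] ds[α,β] : Pred A (a ⊔ ℓ)
      ds[β]   = ds _≺_ (_≡ β)
      ds[α,β] = ds _≺_ (λ x → x ≡ α ⊎ x ≡ β)

      Decomposition : List A → Set (a ⊔ ℓ)
      Decomposition σ' = ∃[ σ₁ ] ∃[ σ₂ ] ∃[ σ₃ ]
        ( (σ' ≡ σ₁ ++ σ₂ ++ σ₃)
        × All ds[β] σ₁
        × (length σ₂ ≤ 1)
        × All (_≡ α) σ₂
        × All ds[α,β] σ₃ )

      All-ds[α,β]-tail : ∀ {γ σ M′} → ds _≺_ (_≡ γ) ⊆ ds[α,β]
                       → Measure _≺_ σ M → Remove (ds _≺_ (_≡ γ)) M M′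
                       → Remove ds[β] M′ N → All (_≺ α) N → All ds[α,β] σ
      All-ds[α,β]-tail ds[γ]⊆ m r₁ r₂ N≺α =
        All-Measure⁻ ds-downward-closed m
          (All-Remove⁻ ds[γ]⊆ r₁
            (All-Remove⁻ (ds-mono inj₂) r₂
              (All.map (λ x≺α → α , inj₁ refl , x≺α) N≺α)))

      decompose : ∀ {σ} → Measure _≺_ σ M → Remove ds[β] M N
                → All (_≺ α) N ⊎ N ≡ [ α ] → Decomposition σ
      decompose [] [] _ = [] , [] , [] , refl , [] , z≤n , [] , []
      decompose ((γ ∷ m) r₁) (drop γ∈ds[β] r₂) bound
        with σ₁ , σ₂ , σ₃ , refl , σ₁∈ , |σ₂|≤1 , σ₂≡α , σ₃∈
               ← decompose m (Remove-⊆-trans (ds-[ γ ]⊆ ds-downward-closed γ∈ds[β]) r₁ r₂) bound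
        = γ ∷ σ₁ , σ₂ , σ₃ , refl , γ∈ds[β] ∷ σ₁∈ , |σ₂|≤1 , σ₂≡α , σ₃∈
      decompose ((γ ∷ m) r₁) (keep _ r₂) (inj₁ (γ≺α ∷ N≺α)) =
        [] , [] , γ ∷ _ , refl , [] , z≤n , [] ,
        γ∈ds[α] ∷ All-ds[α,β]-tail (ds-[ γ ]⊆ ds-downward-closed γ∈ds[α]) m r₁ r₂ N≺α
        where
        γ∈ds[α] : ds[α,β] γ
        γ∈ds[α] = α , inj₁ refl , γ≺α
      decompose ((γ ∷ m) r₁) (keep _ r₂) (inj₂ refl) =
        [] , [ γ ] , _ , refl , [] , s≤s z≤n , refl ∷ [] ,
        All-ds[α,β]-tail (ds-mono inj₁) m r₁ r₂ []

lemma17 : {a ℓ : Level} {A : Set a} (_≺_ : Rel A ℓ)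
    → Transitive _≺_ → Irreflexive _≡_ _≺_
    → (α β : A) (σ' : List A)
    → (∃[ M ] ∃[ N ] (Measure _≺_ σ' M
          × Remove (ds _≺_ (λ x → x ≡ β)) M N
          × _≼mul_ _≺_ N [ α ]))
    → ∃[ σ₁ ] ∃[ σ₂ ] ∃[ σ₃ ]
        ( (σ' ≡ σ₁ ++ σ₂ ++ σ₃)
        × All (ds _≺_ (λ x → x ≡ β)) σ₁
        × (length σ₂ ≤ 1)
        × All (λ x → x ≡ α) σ₂
        × All (ds _≺_ (λ x → (x ≡ α) ⊎ (x ≡ β))) σ₃ )
lemma17 _≺_ ≺-trans _ α β σ' (M , N , |σ'|≡M , M-ds[β]≡N , N≼[α]) =
  decompose ≺-trans α β |σ'|≡M M-ds[β]≡N (≼mul-[ α ]⁻ N≼[α])
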